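{- Let $n\ge 1$ and $C_2=\Gamma_1^{n,3}\cup\Gamma_2^{n,3}$. Then the subgraph of $H(n,3)$ induced by $C_2$ is connected.
   Context: $H(n,3)$ is the graph on $\mathbb{Z}_3^n$ in which two vertices are adjacent iff they differ in exactly one coordinate. For $a\in\mathbb{Z}_3$, $\Gamma_a^{n,3}=\{x\in\mathbb{Z}_3^n: x_1+\cdots+x_n=a\}$ (sum in $\mathbb{Z}_3$). -}

module Defs where

open import Data.Nat using (ℕ; _+_; _%_)
open import Data.Fin using (Fin; toℕ; zero; suc)
open import Data.Vec using (Vec; []; _∷_; lookup)
open import Data.Product using (Σ; _×_; _,_)
open import Data.Sum using (_⊎_)
open import Relation.Binary.PropositionalEquality using (_≡_; _≢_)
open import Relation.Nullary using (¬_)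

ℤ₃ : Set
ℤ₃ = Fin 3

Vertex : ℕ → Set
Vertex n = Vec ℤ₃ n

-- Coordinate sum as a natural number; its residue mod 3 is the ℤ₃-sum.
sumℕ : ∀ {n} → Vertex n → ℕ
sumℕ [] = 0
sumℕ (a ∷ v) = toℕ a + sumℕ v

Γ : (n : ℕ) → ℤ₃ → Vertex n → Set
Γ n a x = sumℕ x % 3 ≡ toℕ a

C₂ : (n : ℕ) → Vertex n → Set
C₂ n x = Γ n (suc zero) x ⊎ Γ n (suc (suc zero)) x

Adj : ∀ {n} → Vertex n → Vertex n → Set
Adj {n} x y = Σ (Fin n) λ i →
  (lookup x i ≢ lookup y i) × (∀ j → j ≢ i → lookup x j ≡ lookup y j)

data Walk {n : ℕ} (S : Vertex n → Set) : Vertex n → Vertex n → Set where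
  [_]  : ∀ {x} → S x → Walk S x x
  step : ∀ {x y z} → S x → Adj x y → Walk S y z → Walk S x z

InducedConnected : ∀ {n} → (Vertex n → Set) → Set
InducedConnected {n} S =
  Σ (Vertex n) S × (∀ x y → S x → S y → Walk S x y)

module Submission where

open import Defs
open import Data.Nat using (ℕ; zero; suc; _+_; _%_; _≥_; _≟_; s≤s)
open import Data.Nat.Properties using (+-assoc; +-identityʳ)
open import Data.Nat.DivMod using (_mod_; m%n<n; m%n%n≡m%n; %-distribˡ-+)
open import Data.Fin as Fin using (toℕ)
open import Data.Fin.Properties using (all?; any?; toℕ-fromℕ<)
open import Data.Vec using ([]; _∷_; replicate; lookup)
open import Data.Product using (∃; _×_; _,_)
open import Data.Sum using (inj₁; inj₂)
open import Function using (id)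
open import Relation.Nullary using (yes; no; contradiction)
open import Relation.Nullary.Decidable using (toWitness; ¬?; _×-dec_)
open import Relation.Binary.PropositionalEquality

-- C₂ consists of the vertices whose coordinate sum is nonzero mod 3.  Fixing
-- the first coordinate a leaves a tail whose sum must avoid −a, so one proves
-- by induction on n that, for every shift c, the vertices with
-- c + Σ xᵢ ≢ 0 (mod 3) induce a connected subgraph.  Two such vertices a ∷ v
-- and b ∷ w with a ≠ b are joined through a ∷ t and b ∷ t, where the tail t
-- avoids both forbidden residues −a and −b, which a nonempty tail can do
-- since there are three residues.

module _ {n : ℕ} {S : Vertex n → Set} where

  _◅◅_ : ∀ {x y z} → Walk S x y → Walk S y z → Walk S x z
  [ _ ] ◅◅ w = w
  step sx x~y u ◅◅ w = step sx x~y (u ◅◅ w)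

map-Walk : ∀ {m n} {S : Vertex m → Set} {T : Vertex n → Set}
           (f : Vertex m → Vertex n) →
           (∀ {x y} → Adj x y → Adj (f x) (f y)) →
           (∀ {x} → S x → T (f x)) →
           ∀ {x y} → Walk S x y → Walk T (f x) (f y)
map-Walk f f-adj f-S [ sx ] = [ f-S sx ]
map-Walk f f-adj f-S (step sx x~y w) = step (f-S sx) (f-adj x~y) (map-Walk f f-adj f-S w)

∷-Adj : ∀ {n} (a : ℤ₃) {v w : Vertex n} → Adj v w → Adj (a ∷ v) (a ∷ w)
∷-Adj a {v} {w} (i , vᵢ≢wᵢ , rest) = Fin.suc i , vᵢ≢wᵢ , agree
  where
  agree : ∀ j → j ≢ Fin.suc i → lookup (a ∷ v) j ≡ lookup (a ∷ w) j
  agree Fin.zero    _   = refl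
  agree (Fin.suc j) j≢i = rest j (λ j≡i → j≢i (cong Fin.suc j≡i))

head-Adj : ∀ {n} {a b : ℤ₃} (v : Vertex n) → a ≢ b → Adj (a ∷ v) (b ∷ v)
head-Adj {a = a} {b} v a≢b = Fin.zero , a≢b , agree
  where
  agree : ∀ j → j ≢ Fin.zero → lookup (a ∷ v) j ≡ lookup (b ∷ v) j
  agree Fin.zero    0≢0 = contradiction refl 0≢0
  agree (Fin.suc j) _   = refl

NonZeroSum : ∀ {n} → ℕ → Vertex n → Set
NonZeroSum c x = (c + sumℕ x) % 3 ≢ 0

NonZeroSum-∷⁺ : ∀ {n} c a (v : Vertex n) → NonZeroSum (c + toℕ a) v → NonZeroSum c (a ∷ v)
NonZeroSum-∷⁺ c a v ok ≡0 = ok (trans (cong (_% 3) (+-assoc c (toℕ a) (sumℕ v))) ≡0)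

NonZeroSum-∷⁻ : ∀ {n} c a (v : Vertex n) → NonZeroSum c (a ∷ v) → NonZeroSum (c + toℕ a) v
NonZeroSum-∷⁻ c a v ok ≡0 = ok (trans (cong (_% 3) (sym (+-assoc c (toℕ a) (sumℕ v)))) ≡0)

sumℕ-replicate-zero : ∀ n → sumℕ (replicate n Fin.zero) ≡ 0
sumℕ-replicate-zero zero    = refl
sumℕ-replicate-zero (suc n) = sumℕ-replicate-zero n

[m+n]%3≡[m%3+n]%3 : ∀ m n → (m + n) % 3 ≡ (m % 3 + n) % 3
[m+n]%3≡[m%3+n]%3 m n = begin
  (m + n) % 3                ≡⟨ %-distribˡ-+ m n 3 ⟩
  (m % 3 + n % 3) % 3        ≡⟨ cong (λ r → (r + n % 3) % 3) (sym (m%n%n≡m%n m 3)) ⟩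
  (m % 3 % 3 + n % 3) % 3    ≡⟨ sym (%-distribˡ-+ (m % 3) n 3) ⟩
  (m % 3 + n) % 3            ∎
  where open ≡-Reasoning

avoid-two-residues : ∀ (p q : ℤ₃) → ∃ λ (s : ℤ₃) →
                     (toℕ p + toℕ s) % 3 ≢ 0 × (toℕ q + toℕ s) % 3 ≢ 0
avoid-two-residues = toWitness {a? = all? λ p → all? λ q → any? λ s →
  ¬? ((toℕ p + toℕ s) % 3 ≟ 0) ×-dec ¬? ((toℕ q + toℕ s) % 3 ≟ 0)} _

sum-residue : ∀ u (s : ℤ₃) n →
              (u + sumℕ (s ∷ replicate n Fin.zero)) % 3 ≡ (toℕ (u mod 3) + toℕ s) % 3
sum-residue u s n = begin
  (u + (toℕ s + sumℕ (replicate n Fin.zero))) % 3  ≡⟨ cong (λ k → (u + (toℕ s + k)) % 3) (sumℕ-replicate-zero n) ⟩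
  (u + (toℕ s + 0)) % 3                            ≡⟨ cong (λ k → (u + k) % 3) (+-identityʳ (toℕ s)) ⟩
  (u + toℕ s) % 3                                  ≡⟨ [m+n]%3≡[m%3+n]%3 u (toℕ s) ⟩
  (u % 3 + toℕ s) % 3                              ≡⟨ cong (λ r → (r + toℕ s) % 3) (sym (toℕ-fromℕ< (m%n<n u 3))) ⟩
  (toℕ (u mod 3) + toℕ s) % 3                      ∎
  where open ≡-Reasoning

common-NonZeroSum : ∀ n u u′ → ∃ λ (t : Vertex (suc n)) → NonZeroSum u t × NonZeroSum u′ t
common-NonZeroSum n u u′ with avoid-two-residues (u mod 3) (u′ mod 3)
... | s , ok , ok′ =
  s ∷ replicate n Fin.zero ,
  (λ ≡0 → ok  (trans (sym (sum-residue u  s n)) ≡0)) ,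
  (λ ≡0 → ok′ (trans (sym (sum-residue u′ s n)) ≡0))

∷-Walk : ∀ {n} c a {v w : Vertex n} →
         Walk (NonZeroSum (c + toℕ a)) v w → Walk (NonZeroSum c) (a ∷ v) (a ∷ w)
∷-Walk c a = map-Walk (a ∷_) (∷-Adj a) (λ {v} → NonZeroSum-∷⁺ c a v)

Preconnected : ∀ {n} → (Vertex n → Set) → Set
Preconnected {n} S = ∀ (x y : Vertex n) → S x → S y → Walk S x y

∷-preconnected : ∀ {n} →
                 (∀ c → Preconnected (NonZeroSum {n} c)) →
                 (∀ u u′ → ∃ λ (t : Vertex n) → NonZeroSum u t × NonZeroSum u′ t) →
                 ∀ c → Preconnected (NonZeroSum {suc n} c)
∷-preconnected conn common c (a ∷ v) (b ∷ w) okx oky with a Fin.≟ b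
... | yes refl = ∷-Walk c a (conn (c + toℕ a) v w (NonZeroSum-∷⁻ c a v okx) (NonZeroSum-∷⁻ c a w oky))
... | no a≢b   = via (common (c + toℕ a) (c + toℕ b))
  where
  via : ∃ (λ t → NonZeroSum (c + toℕ a) t × NonZeroSum (c + toℕ b) t) →
        Walk (NonZeroSum c) (a ∷ v) (b ∷ w)
  via (t , okᵃ , okᵇ) =
    ∷-Walk c a (conn (c + toℕ a) v t (NonZeroSum-∷⁻ c a v okx) okᵃ) ◅◅
    step (NonZeroSum-∷⁺ c a t okᵃ) (head-Adj t a≢b)
         (∷-Walk c b (conn (c + toℕ b) t w okᵇ (NonZeroSum-∷⁻ c b w oky)))

NonZeroSum-preconnected : ∀ n c → Preconnected (NonZeroSum {suc n} c)
NonZeroSum-preconnected zero c (a ∷ []) (b ∷ []) okx oky with a Fin.≟ b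
... | yes refl = [ okx ]
... | no a≢b   = step okx (head-Adj [] a≢b) [ oky ]
NonZeroSum-preconnected (suc n) =
  ∷-preconnected (NonZeroSum-preconnected n) (common-NonZeroSum n)

C₂⇒NonZeroSum : ∀ {n} (x : Vertex n) → C₂ n x → NonZeroSum 0 x
C₂⇒NonZeroSum x (inj₁ ≡1) ≡0 with () ← trans (sym ≡1) ≡0
C₂⇒NonZeroSum x (inj₂ ≡2) ≡0 with () ← trans (sym ≡2) ≡0

NonZeroSum⇒C₂ : ∀ {n} (x : Vertex n) → NonZeroSum 0 x → C₂ n x
NonZeroSum⇒C₂ x ok with sumℕ x % 3 | m%n<n (sumℕ x) 3
... | 0 | _ = contradiction refl ok
... | 1 | _ = inj₁ refl
... | 2 | _ = inj₂ refl
... | suc (suc (suc _)) | s≤s (s≤s (s≤s ()))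

C₂-preconnected : ∀ n → Preconnected (C₂ (suc n))
C₂-preconnected n x y cx cy =
  map-Walk id id (λ {z} → NonZeroSum⇒C₂ z)
    (NonZeroSum-preconnected n 0 x y (C₂⇒NonZeroSum x cx) (C₂⇒NonZeroSum y cy))

lemma10 : (n : ℕ) → n ≥ 1 → InducedConnected (C₂ n)
lemma10 (suc m) _ =
  let t , okt , _ = common-NonZeroSum m 0 0
  in (t , NonZeroSum⇒C₂ t okt) , C₂-preconnected m
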